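{- Let $G$ and $H$ be two graphs on the same vertex set $[n]$. Then $$\hat\delta_1(G,H)\le 3\,\delta_1(G,H).$$
   Context: All graphs are finite, simple, loopless. For graphs $G,H$ of the same order $n$, the edit distance is $$\hat\delta_1(G,H)=\frac{2}{n^2}\min\{|E(G)\triangle \sigma(E(H))| : \sigma:V(H)\to V(G)\text{ bijective}\}.$$ For graphs $G$ on vertex set $\{x_1,\dots,x_m\}$ and $H$ on vertex set $\{y_1,\dots,y_n\}$, the fractional distance $\delta_1(G,H)$ is the minimum, over all non-negative $m\times n$ matrices $A=(\alpha_{i,j})$ with all row sums equal to $1/m$ and all column sums equal to $1/n$, of $$\sum_{(i,j,g,h)\in\Delta}\alpha_{i,g}\alpha_{j,h},$$ where $\Delta$ is the set of quadruples $(i,j,g,h)\in[m]^2\times[n]^2$ such that exactly one of the relations $\{x_i,x_j\}\in E(G)$, $\{y_g,y_h\}\in E(H)$ holds (pairs with $i=j$ or $g=h$ are never edges).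
   Formalization: The non-negative matrices A over which $\delta_1(G,H)$ is minimised have rational entries. -}

module Defs where

open import Data.Nat as ℕ using (ℕ; zero; suc; NonZero)
open import Data.Nat.Properties using (m*n≢0)
open import Data.Integer using (+_)
open import Data.Bool using (Bool; true; false; if_then_else_; _xor_)
open import Data.Fin using (Fin; zero; suc; _<?_)
open import Data.Rational using (ℚ; 0ℚ; _+_; _*_; _/_; _≤_)
open import Relation.Binary.PropositionalEquality using (_≡_)
open import Relation.Nullary.Decidable using (does)
open import Function.Bundles using (_↔_; Inverse)

record Graph (n : ℕ) : Set where
  field
    adj    : Fin n → Fin n → Bool
    sym    : ∀ i j → adj i j ≡ adj j i
    irrefl : ∀ i → adj i i ≡ false
open Graph public

∑ : (n : ℕ) → (Fin n → ℚ) → ℚ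
∑ zero    f = 0ℚ
∑ (suc n) f = f zero + ∑ n (λ i → f (suc i))

count : (n : ℕ) → (Fin n → Bool) → ℕ
count zero    p = zero
count (suc n) p = (if p zero then 1 else 0) ℕ.+ count n (λ i → p (suc i))

∑ℕ : (n : ℕ) → (Fin n → ℕ) → ℕ
∑ℕ zero    f = zero
∑ℕ (suc n) f = f zero ℕ.+ ∑ℕ n (λ i → f (suc i))

-- For a bijection σ : V(H) → V(G) (both = Fin n), the size of
-- E(G) △ σ(E(H)), counted over unordered pairs {u,v} (u < v).
-- {u,v} ∈ σ(E(H))  iff  {σ⁻¹ u, σ⁻¹ v} ∈ E(H).
symDiffSize : {n : ℕ} → Graph n → Graph n → (Fin n ↔ Fin n) → ℕ
symDiffSize {n} G H σ =
  ∑ℕ n (λ u → count n (λ v →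
    if does (u <? v)
    then adj G u v xor adj H (Inverse.from σ u) (Inverse.from σ v)
    else false))

-- (2/n²) · |E(G) △ σ(E(H))| , the quantity minimised in δ̂₁(G,H)
editValue : {n : ℕ} → .{{_ : NonZero n}} → Graph n → Graph n → (Fin n ↔ Fin n) → ℚ
editValue {n} G H σ = ((+ 2) / (n ℕ.* n)) {{m*n≢0 n n}} * ((+ symDiffSize G H σ) / 1)

-- A is a non-negative n×n matrix with all row sums and column sums equal to 1/n
-- (here m = n since both graphs have n vertices).
record IsCoupling (n : ℕ) .{{_ : NonZero n}} (A : Fin n → Fin n → ℚ) : Set where
  field
    nonneg : ∀ i g → 0ℚ ≤ A i g
    rows   : ∀ i → ∑ n (λ g → A i g) ≡ (+ 1) / n
    cols   : ∀ g → ∑ n (λ i → A i g) ≡ (+ 1) / n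

-- the objective minimised in δ₁(G,H): sum over quadruples (i,j,g,h) ∈ Δ of α_{i,g} α_{j,h},
-- where Δ = quadruples with exactly one of {x_i,x_j} ∈ E(G), {y_g,y_h} ∈ E(H).
fracCost : {n : ℕ} → Graph n → Graph n → (Fin n → Fin n → ℚ) → ℚ
fracCost {n} G H A =
  ∑ n (λ i → ∑ n (λ j → ∑ n (λ g → ∑ n (λ h →
    if adj G i j xor adj H g h then A i g * A j h else 0ℚ))))

-- Scale the coupling A so that its rows and columns sum to r = 1/n and linearise the
-- fractional cost F = Σ A(i,g) Δ(i,j,g,h) A(j,h) to c(i,g) = Σ_{j,h} Δ(i,j,g,h) A(j,h), where
-- Δ(i,j,g,h) = 1 iff exactly one of ij ∈ E(G), gh ∈ E(H). A linear cost over doubly stochastic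
-- matrices is minimised at a permutation matrix: while some entry is fractional, a walk through
-- fractional entries closes into an alternating cycle, and moving mass around that cycle in the
-- cheaper direction keeps the margins, does not increase the cost and empties an entry. So some
-- permutation τ has r Σᵢ c(i,τ i) ≤ F. Averaging the triangle inequality
--   Δ(u,v,τu,τv) ≤ Δ(u,v,τu,h) + Δ(l,v,τu,h) + Δ(l,v,τu,τv)
-- with weights A(l,τu) A(v,h) bounds the edit cost r² Σ Δ(u,v,τu,τv) of τ by
-- r Σ c(u,τu) + F + r Σ c(v,τv) ≤ 3F.

module Submission where

open import Defs hiding (sym)
open import Data.Nat using (ℕ; NonZero)
open import Data.Fin using (Fin)
open import Data.Product using (∃)
open import Data.Rational using (ℚ; _*_; _≤_; 1ℚ; _+_)
open import Function.Bundles using (_↔_; Inverse; mk↔ₛ′)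

open import Algebra.Bundles using (Ring)
import Algebra.Properties.Semiring.Sum as SemiringSum
open import Data.Bool using (Bool; true; false; if_then_else_; _xor_)
open import Data.Empty using (⊥-elim)
open import Data.Fin as Fin using (zero; suc; toℕ; inject₁; _<?_)
import Data.Fin.Properties as Fin
import Data.Integer as ℤ
import Data.Integer.Properties as ℤ
open import Data.Nat as ℕ using (zero; suc)
import Data.Nat.Induction as ℕ
import Data.Nat.Properties as ℕ
open import Data.Product using (_×_; _,_; proj₁; proj₂; ∃₂; uncurry)
open import Data.Product.Properties using (≡-dec)
open import Data.Rational as ℚ using (0ℚ; _-_; -_; _<_; _/_; nonNegative)
import Data.Rational.Properties as ℚ
open import Data.Rational.Solver using (module +-*-Solver)
import Data.Rational.Unnormalised as ℚᵘ
import Data.Rational.Unnormalised.Properties as ℚᵘ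
open import Data.Sum using (_⊎_; inj₁; inj₂)
open import Data.Sum.Properties using (inj₁-injective; inj₂-injective)
open import Function.Base using (_∘_; flip; _∋_; _$_)
open import Function.Definitions using (Injective)
open import Function.Properties.Inverse using (↔-sym)
open import Induction.WellFounded using (Acc; acc)
open import Relation.Binary.Definitions using (tri<; tri≈; tri>)
open import Relation.Binary.PropositionalEquality
open import Relation.Nullary using (¬_; Dec; yes; no; does; ¬?; _×-dec_)
open import Relation.Nullary.Decidable using (True; toWitness; dec-true; dec-false)

open +-*-Solver using (solve; _:+_; _:*_; _:-_; _:=_; con)

p≤p+q : ∀ p {q} → 0ℚ ≤ q → p ≤ p + q
p≤p+q p {q} 0≤q = ℚ.≤-trans (ℚ.≤-reflexive (sym (ℚ.+-identityʳ p))) (ℚ.+-monoʳ-≤ p 0≤q)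

p≤q+p : ∀ p {q} → 0ℚ ≤ q → p ≤ q + p
p≤q+p p {q} 0≤q = ℚ.≤-trans (p≤p+q p 0≤q) (ℚ.≤-reflexive (ℚ.+-comm p q))

p≤q⇒0≤q-p : ∀ {p q} → p ≤ q → 0ℚ ≤ q - p
p≤q⇒0≤q-p {p} {q} p≤q = ℚ.≤-trans (ℚ.≤-reflexive (sym (ℚ.+-inverseʳ p))) (ℚ.+-monoˡ-≤ (- p) p≤q)

p-q≤p : ∀ p {q} → 0ℚ ≤ q → p - q ≤ p
p-q≤p p 0≤q = ℚ.≤-trans (ℚ.+-monoʳ-≤ p (ℚ.neg-antimono-≤ 0≤q)) (ℚ.≤-reflexive (ℚ.+-identityʳ p))

p+e*[q-q]≡p : ∀ p e q → p + e * (q - q) ≡ p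
p+e*[q-q]≡p p e q = begin
  p + e * (q - q)  ≡⟨ cong (λ x → p + e * x) (ℚ.+-inverseʳ q) ⟩
  p + e * 0ℚ       ≡⟨ cong (p +_) (ℚ.*-zeroʳ e) ⟩
  p + 0ℚ           ≡⟨ ℚ.+-identityʳ p ⟩
  p                ∎
  where open ≡-Reasoning

nonneg*nonneg : ∀ {p q} → 0ℚ ≤ p → 0ℚ ≤ q → 0ℚ ≤ p * q
nonneg*nonneg {p} {q} 0≤p 0≤q =
  ℚ.nonNegative⁻¹ _ {{ℚ.nonNeg*nonNeg⇒nonNeg p {{nonNegative 0≤p}} q {{nonNegative 0≤q}}}}

-- Finite sums

module Σℚ = SemiringSum (Ring.semiring ℚ.+-*-ring)
module Σℕ = SemiringSum ℕ.+-*-semiring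
open Σℚ using (sum)

sum-cong : ∀ {n} {f g : Fin n → ℚ} → (∀ i → f i ≡ g i) → sum f ≡ sum g
sum-cong = Σℚ.sum-cong-≗

sum-zero : ∀ n → sum {n} (λ _ → 0ℚ) ≡ 0ℚ
sum-zero = Σℚ.sum-replicate-zero

sum-nonneg : ∀ {n} {f : Fin n → ℚ} → (∀ i → 0ℚ ≤ f i) → 0ℚ ≤ sum f
sum-nonneg {zero}  _   = ℚ.≤-refl
sum-nonneg {suc n} f≥0 = ℚ.+-mono-≤ (f≥0 zero) (sum-nonneg (f≥0 ∘ suc))

sum-mono-≤ : ∀ {n} {f g : Fin n → ℚ} → (∀ i → f i ≤ g i) → sum f ≤ sum g
sum-mono-≤ {zero}  _   = ℚ.≤-refl
sum-mono-≤ {suc n} f≤g = ℚ.+-mono-≤ (f≤g zero) (sum-mono-≤ (f≤g ∘ suc))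

sum-neg : ∀ {n} (f : Fin n → ℚ) → sum (λ i → - f i) ≡ - sum f
sum-neg {zero}  f = refl
sum-neg {suc n} f = trans (cong (- f zero +_) (sum-neg (f ∘ suc))) (sym (ℚ.neg-distrib-+ (f zero) _))

sum-affine : ∀ {n} e (x y z : Fin n → ℚ) →
             sum (λ i → x i + e * (y i - z i)) ≡ sum x + e * (sum y - sum z)
sum-affine e x y z = begin
  sum (λ i → x i + e * (y i - z i))         ≡⟨ Σℚ.∑-distrib-+ x _ ⟩
  sum x + sum (λ i → e * (y i - z i))       ≡⟨ cong (sum x +_) (Σℚ.*-distribˡ-sum e (λ i → y i - z i)) ⟨
  sum x + e * sum (λ i → y i - z i)         ≡⟨ cong (λ s → sum x + e * s) (Σℚ.∑-distrib-+ y _) ⟩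
  sum x + e * (sum y + sum (λ i → - z i))   ≡⟨ cong (λ s → sum x + e * (sum y + s)) (sum-neg z) ⟩
  sum x + e * (sum y - sum z)               ∎
  where open ≡-Reasoning

sum-permute : ∀ {n} (π : Fin n ↔ Fin n) (f : Fin n → ℚ) → sum (f ∘ Inverse.to π) ≡ sum f
sum-permute π f = sym (Σℚ.∑-permute f π)

sum²-distrib-+ : ∀ {n} (f g : Fin n → Fin n → ℚ) →
                 sum (λ u → sum λ v → f u v + g u v) ≡ sum (λ u → sum (f u)) + sum (λ u → sum (g u))
sum²-distrib-+ f g = trans (sum-cong (λ u → Σℚ.∑-distrib-+ (f u) (g u))) (Σℚ.∑-distrib-+ (sum ∘ f) (sum ∘ g))

*-distribˡ-sum² : ∀ {n} c (f : Fin n → Fin n → ℚ) → c * sum (λ u → sum (f u)) ≡ sum (λ u → sum λ v → c * f u v)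
*-distribˡ-sum² c f = trans (Σℚ.*-distribˡ-sum c (sum ∘ f)) (sum-cong (λ u → Σℚ.*-distribˡ-sum c (f u)))

term≤sum : ∀ {n} {f : Fin n → ℚ} → (∀ i → 0ℚ ≤ f i) → ∀ i → f i ≤ sum f
term≤sum {suc n} {f} f≥0 zero    = p≤p+q (f zero) (sum-nonneg (f≥0 ∘ suc))
term≤sum {suc n} {f} f≥0 (suc i) =
  ℚ.≤-trans (term≤sum {f = f ∘ suc} (f≥0 ∘ suc) i) (p≤q+p (sum (f ∘ suc)) (f≥0 zero))

pair≤sum : ∀ {n} {f : Fin n → ℚ} → (∀ i → 0ℚ ≤ f i) → ∀ {i j} → i ≢ j → f i + f j ≤ sum f
pair≤sum {suc n}     f≥0 {zero}  {zero}  i≢j = ⊥-elim (i≢j refl)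
pair≤sum {suc n} {f} f≥0 {zero}  {suc j} _   = ℚ.+-monoʳ-≤ (f zero) (term≤sum {f = f ∘ suc} (f≥0 ∘ suc) j)
pair≤sum {suc n} {f} f≥0 {suc i} {zero}  _   =
  ℚ.≤-trans (ℚ.≤-reflexive (ℚ.+-comm (f (suc i)) (f zero))) (ℚ.+-monoʳ-≤ (f zero) (term≤sum {f = f ∘ suc} (f≥0 ∘ suc) i))
pair≤sum {suc n} {f} f≥0 {suc i} {suc j} i≢j =
  ℚ.≤-trans (pair≤sum {f = f ∘ suc} (f≥0 ∘ suc) (i≢j ∘ cong suc)) (p≤q+p (sum (f ∘ suc)) (f≥0 zero))

sum≤term : ∀ {n} {f : Fin n → ℚ} i → (∀ j → j ≢ i → f j ≤ 0ℚ) → sum f ≤ f i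
sum≤term {suc n} {f} zero    others≤0 = ℚ.≤-trans (ℚ.+-monoʳ-≤ (f zero) rest≤0) (ℚ.≤-reflexive (ℚ.+-identityʳ _))
  where
  rest≤0 : sum (f ∘ suc) ≤ 0ℚ
  rest≤0 = ℚ.≤-trans (sum-mono-≤ (λ j → others≤0 (suc j) λ ())) (ℚ.≤-reflexive (sum-zero n))
sum≤term {suc n} {f} (suc i) others≤0 =
  ℚ.≤-trans (ℚ.+-monoˡ-≤ _ (others≤0 zero λ ()))
    (ℚ.≤-trans (ℚ.≤-reflexive (ℚ.+-identityˡ _)) (sum≤term i (λ j j≢i → others≤0 (suc j) (j≢i ∘ Fin.suc-injective))))

δ : ∀ {n} → Fin n → Fin n → ℚ
δ x i = if does (x Fin.≟ i) then 1ℚ else 0ℚ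

δ-nonneg : ∀ {n} (x i : Fin n) → 0ℚ ≤ δ x i
δ-nonneg x i with x Fin.≟ i
... | yes _ = ℚ.nonNegative⁻¹ 1ℚ
... | no _  = ℚ.≤-refl

δ-suc : ∀ {n} (x i : Fin n) → δ (suc x) (suc i) ≡ δ x i
δ-suc x i with x Fin.≟ i
... | yes refl = refl
... | no _     = refl

sum-δ* : ∀ {n} x (f : Fin n → ℚ) → sum (λ i → δ x i * f i) ≡ f x
sum-δ* {suc n} zero f = begin
  1ℚ * f zero + sum (λ i → δ zero (suc i) * f (suc i))
    ≡⟨ cong₂ _+_ (ℚ.*-identityˡ (f zero)) (sum-cong (λ i → ℚ.*-zeroˡ (f (suc i)))) ⟩
  f zero + sum {n} (λ _ → 0ℚ)                          ≡⟨ cong (f zero +_) (sum-zero n) ⟩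
  f zero + 0ℚ                                          ≡⟨ ℚ.+-identityʳ _ ⟩
  f zero                                               ∎
  where open ≡-Reasoning
sum-δ* {suc n} (suc x) f = begin
  0ℚ * f zero + sum (λ i → δ (suc x) (suc i) * f (suc i))
    ≡⟨ cong₂ _+_ (ℚ.*-zeroˡ (f zero)) (sum-cong (λ i → cong (_* f (suc i)) (δ-suc x i))) ⟩
  0ℚ + sum (λ i → δ x i * f (suc i))                      ≡⟨ ℚ.+-identityˡ _ ⟩
  sum (λ i → δ x i * f (suc i))                           ≡⟨ sum-δ* x (f ∘ suc) ⟩
  f (suc x)                                               ∎
  where open ≡-Reasoning

δ-refl : ∀ {n} (x : Fin n) → δ x x ≡ 1ℚ
δ-refl x with x Fin.≟ x
... | yes _   = refl
... | no x≢x = ⊥-elim (x≢x refl)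

δ*δ-off : ∀ {n} {x y i g : Fin n} → (x , y) ≢ (i , g) → δ x i * δ y g ≡ 0ℚ
δ*δ-off {x = x} {y} {i} {g} ≢ with x Fin.≟ i | y Fin.≟ g
... | yes refl | yes refl = ⊥-elim (≢ refl)
... | yes _    | no _     = refl
... | no _     | yes _    = refl
... | no _     | no _     = refl

sum-δ : ∀ {n} (x : Fin n) → sum (δ x) ≡ 1ℚ
sum-δ x = trans (sum-cong (λ i → sym (ℚ.*-identityʳ (δ x i)))) (sum-δ* x (λ _ → 1ℚ))

sum-rotate : ∀ L (f : ℕ → ℚ) → f L ≡ f 0 → sum {L} (f ∘ toℕ) ≡ sum {L} (f ∘ suc ∘ toℕ)
sum-rotate zero    f _       = refl
sum-rotate (suc L) f fL≡f0 = begin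
  f 0 + sum {L} (f ∘ suc ∘ toℕ)                      ≡⟨ ℚ.+-comm (f 0) _ ⟩
  sum {L} (f ∘ suc ∘ toℕ) + f 0                      ≡⟨ cong₂ _+_ (sum-cong {L} (λ i → cong (f ∘ suc) (sym (Fin.toℕ-inject₁ i))))
                                                                  (trans (sym fL≡f0) (cong (f ∘ suc) (sym (Fin.toℕ-fromℕ L)))) ⟩
  sum {L} (f ∘ suc ∘ toℕ ∘ inject₁) + f (suc (toℕ (Fin.fromℕ L)))
                                                     ≡⟨ Σℚ.sum-init-last {L} (f ∘ suc ∘ toℕ) ⟨
  sum {suc L} (f ∘ suc ∘ toℕ)                        ∎
  where open ≡-Reasoning

∃-minimum : ∀ {L} (f : Fin (suc L) → ℚ) → ∃ λ t → ∀ s → f t ≤ f s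
∃-minimum {zero}  f = zero , λ { zero → ℚ.≤-refl }
∃-minimum {suc L} f with ∃-minimum (f ∘ suc)
... | t , ft≤ with ℚ.≤-total (f zero) (f (suc t))
...   | inj₁ f0≤ = zero , λ { zero → ℚ.≤-refl ; (suc s) → ℚ.≤-trans f0≤ (ft≤ s) }
...   | inj₂ ≤f0 = suc t , λ { zero → ≤f0 ; (suc s) → ft≤ s }

-- Doubly stochastic matrices and linear costs

Matrix : ℕ → Set
Matrix n = Fin n → Fin n → ℚ

record DoublyStochastic {n} (r : ℚ) (B : Matrix n) : Set where
  field
    nonneg : ∀ i g → 0ℚ ≤ B i g
    rowSum : ∀ i → sum (B i) ≡ r
    colSum : ∀ g → sum (λ i → B i g) ≡ r

DoublyStochastic-flip : ∀ {n r} {B : Matrix n} → DoublyStochastic r B → DoublyStochastic r (flip B)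
DoublyStochastic-flip ds = record { nonneg = flip nonneg ; rowSum = colSum ; colSum = rowSum }
  where open DoublyStochastic ds

cost : ∀ {n} → Matrix n → Matrix n → ℚ
cost c B = sum λ i → sum λ g → B i g * c i g

cost-flip : ∀ {n} (c B : Matrix n) → cost (flip c) (flip B) ≡ cost c B
cost-flip c B = Σℚ.∑-comm (λ g i → B i g * c i g)

indicator : ∀ {P : Set} → Dec P → ℕ
indicator (yes _) = 1
indicator (no _)  = 0

indicator-mono : ∀ {P Q : Set} → (P → Q) → (p : Dec P) (q : Dec Q) → indicator p ℕ.≤ indicator q
indicator-mono P⇒Q (yes p) (no ¬q) = ⊥-elim (¬q (P⇒Q p))
indicator-mono P⇒Q (yes _) (yes _) = ℕ.≤-refl
indicator-mono P⇒Q (no _)  _       = ℕ.z≤n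

indicator-mono-< : ∀ {P Q : Set} → ¬ P → Q → (p : Dec P) (q : Dec Q) → indicator p ℕ.< indicator q
indicator-mono-< ¬p q (yes p) _       = ⊥-elim (¬p p)
indicator-mono-< ¬p q (no _)  (yes _) = ℕ.≤-refl
indicator-mono-< ¬p q (no _)  (no ¬q) = ⊥-elim (¬q q)

support : ∀ {n} → Matrix n → ℕ
support B = Σℕ.sum λ i → Σℕ.sum λ g → indicator (0ℚ ℚ.<? B i g)

support-flip : ∀ {n} (B : Matrix n) → support (flip B) ≡ support B
support-flip B = Σℕ.∑-comm (λ g i → indicator (0ℚ ℚ.<? B i g))

sumℕ-mono-≤ : ∀ {n} {f g : Fin n → ℕ} → (∀ i → f i ℕ.≤ g i) → Σℕ.sum f ℕ.≤ Σℕ.sum g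
sumℕ-mono-≤ {zero}  _   = ℕ.z≤n
sumℕ-mono-≤ {suc n} f≤g = ℕ.+-mono-≤ (f≤g zero) (sumℕ-mono-≤ (f≤g ∘ suc))

sumℕ-mono-< : ∀ {n} {f g : Fin n → ℕ} → (∀ i → f i ℕ.≤ g i) → ∀ k → f k ℕ.< g k → Σℕ.sum f ℕ.< Σℕ.sum g
sumℕ-mono-< f≤g zero    fk<gk = ℕ.+-mono-<-≤ fk<gk (sumℕ-mono-≤ (f≤g ∘ suc))
sumℕ-mono-< f≤g (suc k) fk<gk = ℕ.+-mono-≤-< (f≤g zero) (sumℕ-mono-< (f≤g ∘ suc) k fk<gk)

support-mono-< : ∀ {n} {B B′ : Matrix n} → (∀ i g → 0ℚ < B′ i g → 0ℚ < B i g) →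
                 ∀ i g → ¬ 0ℚ < B′ i g → 0ℚ < B i g → support B′ ℕ.< support B
support-mono-< {B = B} {B′} B′>0⇒B>0 i g B′≯0 B>0 =
  sumℕ-mono-< (λ i → sumℕ-mono-≤ (λ g → positive-mono i g)) i
    (sumℕ-mono-< (positive-mono i) g (indicator-mono-< B′≯0 B>0 (0ℚ ℚ.<? B′ i g) (0ℚ ℚ.<? B i g)))
  where
  positive-mono : ∀ i g → indicator (0ℚ ℚ.<? B′ i g) ℕ.≤ indicator (0ℚ ℚ.<? B i g)
  positive-mono i g = indicator-mono (B′>0⇒B>0 i g) (0ℚ ℚ.<? B′ i g) (0ℚ ℚ.<? B i g)

Improvable : ∀ {n} → ℚ → Matrix n → Matrix n → Set
Improvable r c B = ∃ λ B′ → DoublyStochastic r B′ × support B′ ℕ.< support B × cost c B′ ≤ cost c B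

improvable-flip : ∀ {n r} {c B : Matrix n} → Improvable r (flip c) (flip B) → Improvable r c B
improvable-flip {c = c} {B} (B′ , ds , smaller , cheaper) =
  flip B′ , DoublyStochastic-flip ds ,
  subst₂ ℕ._<_ (sym (support-flip B′)) (support-flip B) smaller ,
  subst₂ _≤_ (cost-flip c (flip B′)) (cost-flip c B) cheaper

cost-affine : ∀ {n} e (c B P Q : Matrix n) →
              cost c (λ i g → B i g + e * (P i g - Q i g)) ≡ cost c B + e * (cost c P - cost c Q)
cost-affine e c B P Q = begin
  cost c (λ i g → B i g + e * (P i g - Q i g))
    ≡⟨ sum-cong (λ i → sum-cong (λ g → distribute (B i g) (P i g) (Q i g) (c i g))) ⟩
  sum (λ i → sum λ g → weighted B i g + e * (weighted P i g - weighted Q i g))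
    ≡⟨ sum-cong (λ i → sum-affine e (weighted B i) (weighted P i) (weighted Q i)) ⟩
  sum (λ i → sum (weighted B i) + e * (sum (weighted P i) - sum (weighted Q i)))
    ≡⟨ sum-affine e (sum ∘ weighted B) (sum ∘ weighted P) (sum ∘ weighted Q) ⟩
  cost c B + e * (cost c P - cost c Q) ∎
  where
  open ≡-Reasoning
  weighted : Matrix _ → Matrix _
  weighted M i g = M i g * c i g
  distribute : ∀ b p q x → (b + e * (p - q)) * x ≡ b * x + e * (p * x - q * x)
  distribute b p q x = solve 5 (λ b e p q x → (b :+ e :* (p :- q)) :* x := b :* x :+ e :* (p :* x :- q :* x)) refl b e p q x

-- Exchanging mass between two families of entries

occurrences : ∀ {n L} → (Fin L → Fin n × Fin n) → Matrix n
occurrences p i g = sum λ t → δ (proj₁ (p t)) i * δ (proj₂ (p t)) g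

module _ {n L} (p : Fin L → Fin n × Fin n) where

  private
    a b : Fin L → Fin n
    a = proj₁ ∘ p
    b = proj₂ ∘ p

  rowCount colCount : Fin n → ℚ
  rowCount i = sum λ t → δ (a t) i
  colCount g = sum λ t → δ (b t) g

  occurrences-nonneg : ∀ i g → 0ℚ ≤ occurrences p i g
  occurrences-nonneg i g = sum-nonneg λ t → nonneg*nonneg (δ-nonneg (a t) i) (δ-nonneg (b t) g)

  occurrences-rowSum : ∀ i → sum (occurrences p i) ≡ rowCount i
  occurrences-rowSum i = begin
    sum (λ g → sum λ t → δ (a t) i * δ (b t) g)  ≡⟨ Σℚ.∑-comm (λ g t → δ (a t) i * δ (b t) g) ⟩
    sum (λ t → sum λ g → δ (a t) i * δ (b t) g)  ≡⟨ sum-cong (λ t → Σℚ.*-distribˡ-sum (δ (a t) i) (δ (b t))) ⟨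
    sum (λ t → δ (a t) i * sum (δ (b t)))        ≡⟨ sum-cong (λ t → trans (cong (δ (a t) i *_) (sum-δ (b t)))
                                                                          (ℚ.*-identityʳ (δ (a t) i))) ⟩
    rowCount i                                   ∎
    where open ≡-Reasoning

  occurrences-colSum : ∀ g → sum (λ i → occurrences p i g) ≡ colCount g
  occurrences-colSum g = begin
    sum (λ i → sum λ t → δ (a t) i * δ (b t) g)  ≡⟨ Σℚ.∑-comm (λ i t → δ (a t) i * δ (b t) g) ⟩
    sum (λ t → sum λ i → δ (a t) i * δ (b t) g)  ≡⟨ sum-cong (λ t → sum-δ* (a t) (λ _ → δ (b t) g)) ⟩
    colCount g                                   ∎
    where open ≡-Reasoning

  occurrences-cost : ∀ c → cost c (occurrences p) ≡ sum (uncurry c ∘ p)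
  occurrences-cost c = begin
    sum (λ i → sum λ g → sum (λ t → δ (a t) i * δ (b t) g) * c i g)
      ≡⟨ sum-cong (λ i → sum-cong (λ g → Σℚ.*-distribʳ-sum (c i g) (λ t → δ (a t) i * δ (b t) g))) ⟩
    sum (λ i → sum λ g → sum λ t → δ (a t) i * δ (b t) g * c i g)
      ≡⟨ sum-cong (λ i → Σℚ.∑-comm (λ g t → δ (a t) i * δ (b t) g * c i g)) ⟩
    sum (λ i → sum λ t → sum λ g → δ (a t) i * δ (b t) g * c i g)
      ≡⟨ Σℚ.∑-comm (λ i t → sum λ g → δ (a t) i * δ (b t) g * c i g) ⟩
    sum (λ t → sum λ i → sum λ g → δ (a t) i * δ (b t) g * c i g)
      ≡⟨ sum-cong (λ t → sift (a t) (b t)) ⟩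
    sum (uncurry c ∘ p) ∎
    where
    open ≡-Reasoning
    sift : ∀ x y → sum (λ i → sum λ g → δ x i * δ y g * c i g) ≡ c x y
    sift x y = begin
      sum (λ i → sum λ g → δ x i * δ y g * c i g)  ≡⟨ sum-cong (λ i → sum-cong (λ g → ℚ.*-assoc (δ x i) (δ y g) (c i g))) ⟩
      sum (λ i → sum λ g → δ x i * (δ y g * c i g)) ≡⟨ sum-cong (λ i → Σℚ.*-distribˡ-sum (δ x i) (λ g → δ y g * c i g)) ⟨
      sum (λ i → δ x i * sum λ g → δ y g * c i g)   ≡⟨ sum-cong (λ i → cong (δ x i *_) (sum-δ* y (c i))) ⟩
      sum (λ i → δ x i * c i y)                     ≡⟨ sum-δ* x (λ i → c i y) ⟩
      c x y                                         ∎

  occurrences-outside : ∀ {i g} → (∀ t → p t ≢ (i , g)) → occurrences p i g ≡ 0ℚ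
  occurrences-outside {i} {g} ∉p = trans (sum-cong (δ*δ-off ∘ ∉p)) (sum-zero L)

  occurrences-member : Injective _≡_ _≡_ p → ∀ t → uncurry (occurrences p) (p t) ≡ 1ℚ
  occurrences-member p-injective t = trans (sum-cong term) (sum-δ t)
    where
    term : ∀ s → δ (a s) (a t) * δ (b s) (b t) ≡ δ t s
    term s with t Fin.≟ s
    ... | yes refl = cong₂ _*_ (δ-refl (a t)) (δ-refl (b t))
    ... | no t≢s   = δ*δ-off (t≢s ∘ sym ∘ p-injective)

record Exchangeable {n L} (B : Matrix n) (p q : Fin L → Fin n × Fin n) : Set where
  field
    injectiveˡ : Injective _≡_ _≡_ p
    injectiveʳ : Injective _≡_ _≡_ q
    disjoint   : ∀ s t → p s ≢ q t
    positiveˡ  : ∀ t → 0ℚ < uncurry B (p t)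
    positiveʳ  : ∀ t → 0ℚ < uncurry B (q t)
    sameRows   : ∀ i → rowCount p i ≡ rowCount q i
    sameCols   : ∀ g → colCount p g ≡ colCount q g

Exchangeable-sym : ∀ {n L} {B : Matrix n} {p q : Fin L → Fin n × Fin n} → Exchangeable B p q → Exchangeable B q p
Exchangeable-sym ex = record
  { injectiveˡ = injectiveʳ ; injectiveʳ = injectiveˡ ; disjoint = λ s t → disjoint t s ∘ sym
  ; positiveˡ = positiveʳ ; positiveʳ = positiveˡ ; sameRows = sym ∘ sameRows ; sameCols = sym ∘ sameCols }
  where open Exchangeable ex

module _ {n L r} {B : Matrix n} {p q : Fin (suc L) → Fin n × Fin n}
         (ds : DoublyStochastic r B) (ex : Exchangeable B p q) where
  open DoublyStochastic ds
  open Exchangeable ex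

  private
    t₀ : Fin (suc L)
    t₀ = proj₁ (∃-minimum (uncurry B ∘ p))

  ε : ℚ
  ε = uncurry B (p t₀)

  private
    ε-minimal : ∀ t → ε ≤ uncurry B (p t)
    ε-minimal = proj₂ (∃-minimum (uncurry B ∘ p))

    ε≥0 : 0ℚ ≤ ε
    ε≥0 = ℚ.<⇒≤ (positiveˡ t₀)

  exchanged : Matrix n
  exchanged i g = B i g + ε * (occurrences q i g - occurrences p i g)

  exchanged-on-p : ∀ t → uncurry exchanged (p t) ≡ uncurry B (p t) - ε
  exchanged-on-p t = begin
    uncurry B (p t) + ε * (uncurry (occurrences q) (p t) - uncurry (occurrences p) (p t))
      ≡⟨ cong₂ (λ x y → uncurry B (p t) + ε * (x - y)) (occurrences-outside q (λ s → disjoint t s ∘ sym))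
                                                       (occurrences-member p injectiveˡ t) ⟩
    uncurry B (p t) + ε * (0ℚ - 1ℚ)
      ≡⟨ solve 2 (λ b e → b :+ e :* (con 0ℚ :- con 1ℚ) := b :- e) refl (uncurry B (p t)) ε ⟩
    uncurry B (p t) - ε ∎
    where open ≡-Reasoning

  exchanged-off-p : ∀ {i g} → (∀ t → p t ≢ (i , g)) → exchanged i g ≡ B i g + ε * occurrences q i g
  exchanged-off-p {i} {g} ∉p = trans (cong (λ x → B i g + ε * (occurrences q i g - x)) (occurrences-outside p ∉p))
                                     (cong (λ x → B i g + ε * x) (ℚ.+-identityʳ (occurrences q i g)))

  private
    on? : ∀ (f : Fin (suc L) → Fin n × Fin n) i g → Dec (∃ λ t → f t ≡ (i , g))
    on? f i g = Fin.any? (λ t → ≡-dec Fin._≟_ Fin._≟_ (f t) (i , g))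

  exchanged-doublyStochastic : DoublyStochastic r exchanged
  exchanged-doublyStochastic = record
    { nonneg = nonneg′
    ; rowSum = λ i → trans (sum-affine ε (B i) (occurrences q i) (occurrences p i))
                 (balanced (rowSum i) (occurrences-rowSum q i) (trans (occurrences-rowSum p i) (sameRows i)))
    ; colSum = λ g → trans (sum-affine ε (λ i → B i g) (λ i → occurrences q i g) (λ i → occurrences p i g))
                 (balanced (colSum g) (occurrences-colSum q g) (trans (occurrences-colSum p g) (sameCols g)))
    }
    where
    nonneg′ : ∀ i g → 0ℚ ≤ exchanged i g
    nonneg′ i g with on? p i g
    ... | yes (t , refl) = ℚ.≤-trans (p≤q⇒0≤q-p (ε-minimal t)) (ℚ.≤-reflexive (sym (exchanged-on-p t)))
    ... | no ∉p = ℚ.≤-trans (ℚ.+-mono-≤ (nonneg i g) (nonneg*nonneg ε≥0 (occurrences-nonneg q i g)))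
                    (ℚ.≤-reflexive (sym (exchanged-off-p (λ t eq → ∉p (t , eq)))))
    balanced : ∀ {m m′ mq mp} → m ≡ r → mq ≡ m′ → mp ≡ m′ → m + ε * (mq - mp) ≡ r
    balanced {m′ = m′} refl refl refl = p+e*[q-q]≡p r ε m′

  exchanged-support-< : support exchanged ℕ.< support B
  exchanged-support-< = support-mono-< positive⇒positive (proj₁ (p t₀)) (proj₂ (p t₀))
    (λ emptied>0 → ℚ.<-irrefl refl (ℚ.<-≤-trans emptied>0 (ℚ.≤-reflexive (trans (exchanged-on-p t₀) (ℚ.+-inverseʳ ε)))))
    (positiveˡ t₀)
    where
    positive⇒positive : ∀ i g → 0ℚ < exchanged i g → 0ℚ < B i g
    positive⇒positive i g B′>0 with on? p i g | on? q i g
    ... | yes (t , refl) | _              = ℚ.<-≤-trans B′>0 (ℚ.≤-trans (ℚ.≤-reflexive (exchanged-on-p t)) (p-q≤p _ ε≥0))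
    ... | no _           | yes (t , refl) = positiveʳ t
    ... | no ∉p          | no ∉q          = ℚ.<-≤-trans B′>0 (ℚ.≤-reflexive (begin
      exchanged i g                   ≡⟨ exchanged-off-p (λ t eq → ∉p (t , eq)) ⟩
      B i g + ε * occurrences q i g   ≡⟨ cong (λ x → B i g + ε * x) (occurrences-outside q (λ t eq → ∉q (t , eq))) ⟩
      B i g + ε * 0ℚ                  ≡⟨ p+e*[q-q]≡p (B i g) ε 0ℚ ⟩
      B i g                           ∎))
      where open ≡-Reasoning

  exchanged-cost : ∀ c → cost c exchanged ≡ cost c B + ε * (sum (uncurry c ∘ q) - sum (uncurry c ∘ p))
  exchanged-cost c = trans (cost-affine ε c B (occurrences q) (occurrences p))
    (cong₂ (λ x y → cost c B + ε * (x - y)) (occurrences-cost q c) (occurrences-cost p c))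

  exchange : ∀ {c} → sum (uncurry c ∘ q) ≤ sum (uncurry c ∘ p) → Improvable r c B
  exchange {c} q-cheaper = exchanged , exchanged-doublyStochastic , exchanged-support-< , (begin
    cost c exchanged
      ≡⟨ exchanged-cost c ⟩
    cost c B + ε * (sum (uncurry c ∘ q) - sum (uncurry c ∘ p))
      ≤⟨ ℚ.+-monoʳ-≤ (cost c B) (ℚ.*-monoˡ-≤-nonNeg ε {{nonNegative ε≥0}} (ℚ.+-monoˡ-≤ _ q-cheaper)) ⟩
    cost c B + ε * (sum (uncurry c ∘ p) - sum (uncurry c ∘ p))
      ≡⟨ p+e*[q-q]≡p (cost c B) ε (sum (uncurry c ∘ p)) ⟩
    cost c B ∎)
    where open ℚ.≤-Reasoning

exchange-improves : ∀ {n L r} {c B : Matrix n} {p q : Fin (suc L) → Fin n × Fin n} →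
                    DoublyStochastic r B → Exchangeable B p q → Improvable r c B
exchange-improves {c = c} {p = p} {q} ds ex with ℚ.≤-total (sum (uncurry c ∘ q)) (sum (uncurry c ∘ p))
... | inj₁ q-cheaper = exchange ds ex q-cheaper
... | inj₂ p-cheaper = exchange ds (Exchangeable-sym ex) p-cheaper

-- Alternating walks

record AlternatingWalk {n} (B : Matrix n) : Set where
  field
    row col       : ℕ → Fin n
    positive-at   : ∀ t → 0ℚ < B (row t) (col t)
    positive-next : ∀ t → 0ℚ < B (row (suc t)) (col t)
    row-moves     : ∀ t → row (suc t) ≢ row t
    col-moves     : ∀ t → col (suc t) ≢ col t

module _ {n} {B : Matrix n} (W : AlternatingWalk B) where
  open AlternatingWalk W

  drop : ℕ → AlternatingWalk B
  drop p = record
    { row = λ t → row (t ℕ.+ p) ; col = λ t → col (t ℕ.+ p)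
    ; positive-at = λ t → positive-at (t ℕ.+ p) ; positive-next = λ t → positive-next (t ℕ.+ p)
    ; row-moves = λ t → row-moves (t ℕ.+ p) ; col-moves = λ t → col-moves (t ℕ.+ p)
    }

  AlternatingWalk-flip : AlternatingWalk (flip B)
  AlternatingWalk-flip = record
    { row = col ; col = row ∘ suc
    ; positive-at = positive-next ; positive-next = positive-at ∘ suc
    ; row-moves = col-moves ; col-moves = row-moves ∘ suc
    }

  closed-walk-improves : ∀ {r} {c : Matrix n} → DoublyStochastic r B → ∀ L → row (suc L) ≡ row 0 →
                         (∀ (s t : Fin (suc L)) → col (toℕ s) ≡ col (toℕ t) → s ≡ t) → Improvable r c B
  closed-walk-improves ds L closes col-injective = exchange-improves {p = here} {q = next} ds record
    { injectiveˡ = λ {s} {t} eq → col-injective s t (cong proj₂ eq)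
    ; injectiveʳ = λ {s} {t} eq → col-injective s t (cong proj₂ eq)
    ; disjoint   = disjoint
    ; positiveˡ  = positive-at ∘ toℕ
    ; positiveʳ  = positive-next ∘ toℕ
    ; sameRows   = λ i → sum-rotate (suc L) (λ k → δ (row k) i) (cong (λ x → δ x i) closes)
    ; sameCols   = λ _ → refl
    }
    where
    here next : Fin (suc L) → Fin n × Fin n
    here t = row (toℕ t) , col (toℕ t)
    next t = row (suc (toℕ t)) , col (toℕ t)
    disjoint : ∀ s t → here s ≢ next t
    disjoint s t eq with col-injective s t (cong proj₂ eq)
    ... | refl = row-moves (toℕ s) (sym (cong proj₁ eq))

InjectiveBelow : ∀ {A : Set} → (ℕ → A) → ℕ → Set
InjectiveBelow v b = ∀ {x y} → x ℕ.< b → y ℕ.< b → v x ≡ v y → x ≡ y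

FirstRepeat : ∀ {A : Set} → (ℕ → A) → Set
FirstRepeat v = ∃₂ λ a b → a ℕ.< b × v a ≡ v b × InjectiveBelow v b

injectiveBelow-or-repeat : ∀ {k} (v : ℕ → Fin k) b → InjectiveBelow v b ⊎ FirstRepeat v
injectiveBelow-or-repeat v zero = inj₁ λ ()
injectiveBelow-or-repeat v (suc b) with injectiveBelow-or-repeat v b
... | inj₂ repeat = inj₂ repeat
... | inj₁ injective with Fin.any? (λ (a : Fin b) → v (toℕ a) Fin.≟ v b)
...   | yes (a , va≡vb) = inj₂ (toℕ a , b , Fin.toℕ<n a , va≡vb , injective)
...   | no fresh = inj₁ extended
  where
  earlier : ∀ {x} → x ℕ.< b → v x ≢ v b
  earlier {x} x<b vx≡vb = fresh (Fin.fromℕ< x<b , trans (cong v (Fin.toℕ-fromℕ< x<b)) vx≡vb)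
  extended : InjectiveBelow v (suc b)
  extended {x} {y} x≤b y≤b vx≡vy with ℕ.m≤n⇒m<n∨m≡n (ℕ.≤-pred x≤b) | ℕ.m≤n⇒m<n∨m≡n (ℕ.≤-pred y≤b)
  ... | inj₁ x<b  | inj₁ y<b  = injective x<b y<b vx≡vy
  ... | inj₁ x<b  | inj₂ refl = ⊥-elim (earlier x<b vx≡vy)
  ... | inj₂ refl | inj₁ y<b  = ⊥-elim (earlier y<b (sym vx≡vy))
  ... | inj₂ refl | inj₂ refl = refl

first-repeat : ∀ {k} (v : ℕ → Fin k) → FirstRepeat v
first-repeat {k} v with injectiveBelow-or-repeat v (suc k)
... | inj₂ repeat    = repeat
... | inj₁ injective = ⊥-elim (ℕ.<-irrefl refl (Fin.injective⇒≤ {f = v ∘ toℕ} λ {x} {y} →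
                         Fin.toℕ-injective ∘ injective (Fin.toℕ<n x) (Fin.toℕ<n y)))

interleave : ∀ {A B : Set} → (ℕ → A) → (ℕ → B) → ℕ → A ⊎ B
interleave x y zero          = inj₁ (x 0)
interleave x y (suc zero)    = inj₂ (y 0)
interleave x y (suc (suc k)) = interleave (x ∘ suc) (y ∘ suc) k

interleave-even : ∀ {A B : Set} (x : ℕ → A) (y : ℕ → B) k → interleave x y (k ℕ.+ k) ≡ inj₁ (x k)
interleave-even x y zero    = refl
interleave-even x y (suc k) rewrite ℕ.+-suc k k = interleave-even (x ∘ suc) (y ∘ suc) k

interleave-odd : ∀ {A B : Set} (x : ℕ → A) (y : ℕ → B) k → interleave x y (suc (k ℕ.+ k)) ≡ inj₂ (y k)
interleave-odd x y zero    = refl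
interleave-odd x y (suc k) rewrite ℕ.+-suc k k = interleave-odd (x ∘ suc) (y ∘ suc) k

parity : ∀ m → ∃ λ k → m ≡ k ℕ.+ k ⊎ m ≡ suc (k ℕ.+ k)
parity zero    = zero , inj₁ refl
parity (suc m) with parity m
... | k , inj₁ refl = k , inj₂ refl
... | k , inj₂ refl = suc k , inj₁ (cong suc (sym (ℕ.+-suc k k)))

double-cancel-≤ : ∀ {m n} → m ℕ.+ m ℕ.≤ n ℕ.+ n → m ℕ.≤ n
double-cancel-≤ h = ℕ.≮⇒≥ (λ n<m → ℕ.<⇒≱ (ℕ.+-mono-< n<m n<m) h)

double-cancel-< : ∀ {m n} → m ℕ.+ m ℕ.< n ℕ.+ n → m ℕ.< n
double-cancel-< h = ℕ.≰⇒> (λ n≤m → ℕ.<⇒≱ h (ℕ.+-mono-≤ n≤m n≤m))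

double-injective : ∀ {m n} → m ℕ.+ m ≡ n ℕ.+ n → m ≡ n
double-injective eq = ℕ.≤-antisym (double-cancel-≤ (ℕ.≤-reflexive eq)) (double-cancel-≤ (ℕ.≤-reflexive (sym eq)))

InjectiveOn : ∀ {A : Set} → (ℕ → A) → ℕ → ℕ → Set
InjectiveOn f p L = ∀ (s t : Fin (suc L)) → f (toℕ s ℕ.+ p) ≡ f (toℕ t ℕ.+ p) → s ≡ t

segment : ∀ {p q} → p ℕ.< q → ∃ λ L → suc L ℕ.+ p ≡ q × ∀ (s : Fin (suc L)) → toℕ s ℕ.+ p ℕ.< q
segment {p} {q} p<q = L , closes , λ s → subst (toℕ s ℕ.+ p ℕ.<_) closes (ℕ.+-monoˡ-< p (Fin.toℕ<n s))
  where
  L : ℕ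
  L = proj₁ (ℕ.m≤n⇒∃[o]m+o≡n p<q)
  closes : suc L ℕ.+ p ≡ q
  closes = trans (cong suc (ℕ.+-comm L p)) (proj₂ (ℕ.m≤n⇒∃[o]m+o≡n p<q))

inj₁≢inj₂ : ∀ {A B : Set} {a : A} {b : B} → (A ⊎ B ∋ inj₁ a) ≢ inj₂ b
inj₁≢inj₂ ()

module _ {n} (x y : ℕ → Fin n) where

  ClosingSegment : Set
  ClosingSegment = ∃₂ λ p L → (x (suc L ℕ.+ p) ≡ x p × InjectiveOn y p L)
                            ⊎ (y (suc L ℕ.+ p) ≡ y p × InjectiveOn (x ∘ suc) p L)

  closing-segment-from-repeat : ∀ {a b} → a ℕ.< b → interleave x y a ≡ interleave x y b →
                                InjectiveBelow (interleave x y) b → ClosingSegment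
  closing-segment-from-repeat {a} {b} a<b repeat injective with parity a | parity b
  ... | p , inj₁ refl | q , inj₁ refl = p , L , inj₁ (closes-x , y-injective)
    where
    p<q : p ℕ.< q
    p<q = double-cancel-< a<b
    L : ℕ
    L = proj₁ (segment p<q)
    bound : ∀ (s : Fin (suc L)) → toℕ s ℕ.+ p ℕ.< q
    bound = proj₂ (proj₂ (segment p<q))
    closes-x : x (suc L ℕ.+ p) ≡ x p
    closes-x = trans (cong x (proj₁ (proj₂ (segment p<q))))
                 (sym (inj₁-injective (trans (sym (interleave-even x y p)) (trans repeat (interleave-even x y q)))))
    odd< : ∀ {i} → i ℕ.< q → suc (i ℕ.+ i) ℕ.< q ℕ.+ q
    odd< {i} i<q = ℕ.≤-trans (ℕ.≤-reflexive (cong suc (sym (ℕ.+-suc i i)))) (ℕ.+-mono-≤ i<q i<q)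
    y-injective : InjectiveOn y p L
    y-injective s t eq = Fin.toℕ-injective (ℕ.+-cancelʳ-≡ p _ _ (double-injective (ℕ.suc-injective
      (injective (odd< (bound s)) (odd< (bound t))
        (trans (interleave-odd x y _) (trans (cong inj₂ eq) (sym (interleave-odd x y _))))))))
  ... | p , inj₂ refl | q , inj₂ refl = p , L , inj₂ (closes-y , x-injective)
    where
    p<q : p ℕ.< q
    p<q = double-cancel-< (ℕ.≤-pred a<b)
    L : ℕ
    L = proj₁ (segment p<q)
    bound : ∀ (s : Fin (suc L)) → toℕ s ℕ.+ p ℕ.< q
    bound = proj₂ (proj₂ (segment p<q))
    closes-y : y (suc L ℕ.+ p) ≡ y p
    closes-y = trans (cong y (proj₁ (proj₂ (segment p<q))))
                 (sym (inj₂-injective (trans (sym (interleave-odd x y p)) (trans repeat (interleave-odd x y q)))))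
    even< : ∀ {i} → i ℕ.< q → suc i ℕ.+ suc i ℕ.< suc (q ℕ.+ q)
    even< i<q = ℕ.s≤s (ℕ.+-mono-≤ i<q i<q)
    x-injective : InjectiveOn (x ∘ suc) p L
    x-injective s t eq = Fin.toℕ-injective (ℕ.+-cancelʳ-≡ p _ _ (ℕ.suc-injective (double-injective
      (injective (even< (bound s)) (even< (bound t))
        (trans (interleave-even x y _) (trans (cong inj₁ eq) (sym (interleave-even x y _))))))))
  ... | p , inj₁ refl | q , inj₂ refl =
    ⊥-elim (inj₁≢inj₂ (trans (sym (interleave-even x y p)) (trans repeat (interleave-odd x y q))))
  ... | p , inj₂ refl | q , inj₁ refl =
    ⊥-elim (inj₁≢inj₂ (trans (sym (interleave-even x y q)) (trans (sym repeat) (interleave-odd x y p))))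

  -- The first repeated vertex of x 0, y 0, x 1, y 1, … closes a cycle along which
  -- no other vertex repeats.
  closing-segment : ClosingSegment
  closing-segment with first-repeat (Fin.join n n ∘ interleave x y)
  ... | a , b , a<b , repeat , injective = closing-segment-from-repeat a<b (join-cancel repeat)
                                              (λ i<b j<b → injective i<b j<b ∘ cong (Fin.join n n))
    where
    join-cancel : ∀ {u v} → Fin.join n n u ≡ Fin.join n n v → u ≡ v
    join-cancel {u} {v} eq = subst₂ _≡_ (Fin.splitAt-join n n u) (Fin.splitAt-join n n v) (cong (Fin.splitAt n) eq)

-- Linear costs are minimised at permutations

walk-improves : ∀ {n r} {c B : Matrix n} → DoublyStochastic r B → AlternatingWalk B → Improvable r c B
walk-improves ds W with closing-segment (AlternatingWalk.row W) (AlternatingWalk.col W)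
... | p , L , inj₁ (closes , injective) = closed-walk-improves (drop W p) ds L closes injective
... | p , L , inj₂ (closes , injective) =
  -- a cycle closing at a column closes at a row of the transposed walk
  improvable-flip (closed-walk-improves (AlternatingWalk-flip (drop W p)) (DoublyStochastic-flip ds) L closes injective)

Fractional : ℚ → ℚ → Set
Fractional r x = 0ℚ < x × x < r

fractional-partner : ∀ {n r} {f : Fin n → ℚ} → (∀ j → 0ℚ ≤ f j) → sum f ≡ r →
                     ∀ {i} → Fractional r (f i) → ∃ λ j → j ≢ i × Fractional r (f j)
fractional-partner {r = r} {f} f≥0 sum≡r {i} (fi>0 , fi<r)
  with Fin.any? (λ j → ¬? (j Fin.≟ i) ×-dec (0ℚ ℚ.<? f j))
... | yes (j , j≢i , fj>0) = j , j≢i , fj>0 , (begin-strict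
  f j           ≡⟨ ℚ.+-identityˡ (f j) ⟨
  0ℚ + f j      <⟨ ℚ.+-monoˡ-< (f j) fi>0 ⟩
  f i + f j     ≤⟨ pair≤sum f≥0 (j≢i ∘ sym) ⟩
  sum f         ≡⟨ sum≡r ⟩
  r             ∎)
  where open ℚ.≤-Reasoning
... | no none = ⊥-elim (ℚ.<-irrefl refl (begin-strict
  r             ≡⟨ sum≡r ⟨
  sum f         ≤⟨ sum≤term i (λ j j≢i → ℚ.≮⇒≥ (λ fj>0 → none (j , j≢i , fj>0))) ⟩
  f i           <⟨ fi<r ⟩
  r             ∎))
  where open ℚ.≤-Reasoning

module _ {n r} {B : Matrix n} (ds : DoublyStochastic r B) where
  open DoublyStochastic ds

  FractionalEntry : Fin n × Fin n → Set
  FractionalEntry (i , g) = Fractional r (B i g)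

  fractional-walk : ∃ FractionalEntry → AlternatingWalk B
  fractional-walk start = record
    { row = proj₁ ∘ proj₁ ∘ position ; col = proj₂ ∘ proj₁ ∘ position
    ; positive-at   = proj₁ ∘ proj₂ ∘ position
    ; positive-next = proj₁ ∘ proj₂ ∘ proj₂ ∘ row-step ∘ position
    ; row-moves     = proj₁ ∘ proj₂ ∘ row-step ∘ position
    ; col-moves     = proj₁ ∘ proj₂ ∘ col-step ∘ position
    }
    where
    row-step : (s : ∃ FractionalEntry) → ∃ λ i → i ≢ proj₁ (proj₁ s) × Fractional r (B i (proj₂ (proj₁ s)))
    row-step s = fractional-partner (λ i → nonneg i _) (colSum _) (proj₂ s)
    col-step : (s : ∃ FractionalEntry) → ∃ λ g → g ≢ proj₂ (proj₁ s) × Fractional r (B (proj₁ (row-step s)) g)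
    col-step s = fractional-partner (nonneg _) (rowSum _) (proj₂ (proj₂ (row-step s)))
    position : ℕ → ∃ FractionalEntry
    position zero    = start
    position (suc t) = (proj₁ (row-step s) , proj₁ (col-step s)) , proj₂ (proj₂ (col-step s))
      where
      s : ∃ FractionalEntry
      s = position t

module _ {n r} {f : Fin n → ℚ} (r>0 : 0ℚ < r) (f≥0 : ∀ j → 0ℚ ≤ f j) (sum≡r : sum f ≡ r)
         (integral : ∀ j → ¬ Fractional r (f j)) where

  zero-or-full : ∀ j → f j ≡ 0ℚ ⊎ f j ≡ r
  zero-or-full j with 0ℚ ℚ.<? f j
  ... | yes fj>0 = inj₂ (ℚ.≤-antisym (ℚ.≤-trans (term≤sum f≥0 j) (ℚ.≤-reflexive sum≡r))
                                     (ℚ.≮⇒≥ (λ fj<r → integral j (fj>0 , fj<r))))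
  ... | no fj≯0  = inj₁ (ℚ.≤-antisym (ℚ.≮⇒≥ fj≯0) (f≥0 j))

  full-unique : ∀ {j k} → f j ≡ r → f k ≡ r → j ≡ k
  full-unique {j} {k} fj≡r fk≡r with j Fin.≟ k
  ... | yes j≡k = j≡k
  ... | no j≢k  = ⊥-elim (ℚ.<-irrefl refl (begin-strict
    r             ≡⟨ ℚ.+-identityʳ r ⟨
    r + 0ℚ        <⟨ ℚ.+-monoʳ-< r r>0 ⟩
    r + r         ≡⟨ cong₂ _+_ fj≡r fk≡r ⟨
    f j + f k     ≤⟨ pair≤sum f≥0 j≢k ⟩
    sum f         ≡⟨ sum≡r ⟩
    r             ∎))
    where open ℚ.≤-Reasoning

  ∃-full : ∃ λ j → f j ≡ r
  ∃-full with Fin.any? (λ j → f j ℚ.≟ r)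
  ... | yes full = full
  ... | no none  = ⊥-elim (ℚ.<-irrefl (trans (sym (sum-zero n)) (trans (sum-cong all-zero) sum≡r)) r>0)
    where
    all-zero : ∀ j → 0ℚ ≡ f j
    all-zero j with zero-or-full j
    ... | inj₁ fj≡0 = sym fj≡0
    ... | inj₂ fj≡r = ⊥-elim (none (j , fj≡r))

  full-entries : ∀ {j} → f j ≡ r → ∀ k → f k ≡ δ j k * r
  full-entries {j} fj≡r k with j Fin.≟ k
  ... | yes refl = trans fj≡r (sym (ℚ.*-identityˡ r))
  ... | no j≢k with zero-or-full k
  ...   | inj₁ fk≡0 = trans fk≡0 (sym (ℚ.*-zeroˡ r))
  ...   | inj₂ fk≡r = ⊥-elim (j≢k (full-unique fj≡r fk≡r))

module _ {n r} {B : Matrix n} (r>0 : 0ℚ < r) (ds : DoublyStochastic r B)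
         (integral : ∀ i g → ¬ Fractional r (B i g)) where
  open DoublyStochastic ds

  private
    row-full : ∀ i → ∃ λ g → B i g ≡ r
    row-full i = ∃-full r>0 (nonneg i) (rowSum i) (integral i)

    col-full : ∀ g → ∃ λ i → B i g ≡ r
    col-full g = ∃-full r>0 (λ i → nonneg i g) (colSum g) (λ i → integral i g)

  integral-permutation : Fin n ↔ Fin n
  integral-permutation = mk↔ₛ′ (proj₁ ∘ row-full) (proj₁ ∘ col-full) to-from from-to
    where
    to-from : ∀ g → proj₁ (row-full (proj₁ (col-full g))) ≡ g
    to-from g = full-unique r>0 (nonneg i) (rowSum i) (integral i) (proj₂ (row-full i)) (proj₂ (col-full g))
      where
      i : Fin n
      i = proj₁ (col-full g)
    from-to : ∀ i → proj₁ (col-full (proj₁ (row-full i))) ≡ i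
    from-to i = full-unique r>0 (λ i → nonneg i g) (colSum g) (λ i → integral i g) (proj₂ (col-full g)) (proj₂ (row-full i))
      where
      g : Fin n
      g = proj₁ (row-full i)

  integral-cost : ∀ c → r * sum (λ i → c i (Inverse.to integral-permutation i)) ≡ cost c B
  integral-cost c = begin
    r * sum (λ i → c i (π i))                 ≡⟨ Σℚ.*-distribˡ-sum r (λ i → c i (π i)) ⟩
    sum (λ i → r * c i (π i))                 ≡⟨ sum-cong (λ i → sum-δ* (π i) (λ g → r * c i g)) ⟨
    sum (λ i → sum λ g → δ (π i) g * (r * c i g))
      ≡⟨ sum-cong (λ i → sum-cong (λ g → trans (sym (ℚ.*-assoc (δ (π i) g) r (c i g)))
           (cong (_* c i g) (sym (full-entries r>0 (nonneg i) (rowSum i) (integral i) (proj₂ (row-full i)) g))))) ⟩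
    cost c B                                  ∎
    where
    open ≡-Reasoning
    π : Fin n → Fin n
    π = Inverse.to integral-permutation

permutation-cost-≤ : ∀ {n r} {c B : Matrix n} → 0ℚ < r → DoublyStochastic r B →
                     ∃ λ (π : Fin n ↔ Fin n) → r * sum (λ i → c i (Inverse.to π i)) ≤ cost c B
permutation-cost-≤ {n} {r} {c} {B} r>0 ds₀ = go B ds₀ (ℕ.<-wellFounded (support B))
  where
  go : ∀ B → DoublyStochastic r B → Acc ℕ._<_ (support B) →
       ∃ λ (π : Fin n ↔ Fin n) → r * sum (λ i → c i (Inverse.to π i)) ≤ cost c B
  go B ds (acc smaller) with Fin.any? (λ i → Fin.any? (λ g → (0ℚ ℚ.<? B i g) ×-dec (B i g ℚ.<? r)))
  ... | yes (i , g , fractional) with walk-improves ds (fractional-walk ds ((i , g) , fractional))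
  ...   | B′ , ds′ , fewer , cheaper with go B′ ds′ (smaller fewer)
  ...     | π , bound = π , ℚ.≤-trans bound cheaper
  go B ds (acc smaller) | no none =
    integral-permutation r>0 ds integral , ℚ.≤-reflexive (integral-cost r>0 ds integral c)
    where
    integral : ∀ i g → ¬ Fractional r (B i g)
    integral i g fractional = none (i , g , fractional)

-- Averaging the triangle inequality

module _ {n r} (a b : Fin n → ℚ) (sum-a : sum a ≡ r) (sum-b : sum b ≡ r) where

  weighted-sum : ∀ (f : Fin n → Fin n → ℚ) →
                 sum (λ l → sum λ h → a l * (b h * f l h)) ≡ sum (λ l → a l * sum λ h → f l h * b h)
  weighted-sum f = sum-cong λ l → trans (sym (Σℚ.*-distribˡ-sum (a l) (λ h → b h * f l h)))
                                       (cong (a l *_) (sum-cong (λ h → ℚ.*-comm (b h) (f l h))))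

  weighted-sumʳ : ∀ (f : Fin n → ℚ) → sum (λ l → sum λ h → a l * (b h * f h)) ≡ r * sum (λ h → f h * b h)
  weighted-sumʳ f = begin
    sum (λ l → sum λ h → a l * (b h * f h))  ≡⟨ weighted-sum (λ _ → f) ⟩
    sum (λ l → a l * sum λ h → f h * b h)    ≡⟨ Σℚ.*-distribʳ-sum (sum λ h → f h * b h) a ⟨
    sum a * sum (λ h → f h * b h)            ≡⟨ cong (_* sum (λ h → f h * b h)) sum-a ⟩
    r * sum (λ h → f h * b h)                ∎
    where open ≡-Reasoning

  weighted-sumˡ : ∀ (f : Fin n → ℚ) → sum (λ l → sum λ h → a l * (b h * f l)) ≡ r * sum (λ l → f l * a l)
  weighted-sumˡ f = begin
    sum (λ l → sum λ h → a l * (b h * f l))  ≡⟨ weighted-sum (λ l _ → f l) ⟩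
    sum (λ l → a l * sum λ h → f l * b h)    ≡⟨ sum-cong (λ l → cong (a l *_) (sym (Σℚ.*-distribˡ-sum (f l) b))) ⟩
    sum (λ l → a l * (f l * sum b))          ≡⟨ sum-cong (λ l → cong (λ s → a l * (f l * s)) sum-b) ⟩
    sum (λ l → a l * (f l * r))              ≡⟨ sum-cong (λ l → solve 3 (λ a f r → a :* (f :* r) := r :* (f :* a))
                                                                      refl (a l) (f l) r) ⟩
    sum (λ l → r * (f l * a l))              ≡⟨ Σℚ.*-distribˡ-sum r (λ l → f l * a l) ⟨
    r * sum (λ l → f l * a l)                ∎
    where open ≡-Reasoning

  weighted-const : ∀ t → sum (λ l → sum λ h → a l * (b h * t)) ≡ r * r * t
  weighted-const t = begin
    sum (λ l → sum λ h → a l * (b h * t))  ≡⟨ weighted-sumˡ (λ _ → t) ⟩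
    r * sum (λ l → t * a l)                ≡⟨ cong (r *_) (Σℚ.*-distribˡ-sum t a) ⟨
    r * (t * sum a)                        ≡⟨ cong (λ s → r * (t * s)) sum-a ⟩
    r * (t * r)                            ≡⟨ solve 2 (λ r t → r :* (t :* r) := r :* r :* t) refl r t ⟩
    r * r * t                              ∎
    where open ≡-Reasoning

linearised : ∀ {n} → (Fin n → Fin n → Fin n → Fin n → ℚ) → Matrix n → Matrix n
linearised Δ A i g = sum λ j → sum λ h → Δ i j g h * A j h

record Discrepancy (n : ℕ) : Set where
  field
    Δ          : Fin n → Fin n → Fin n → Fin n → ℚ
    Δ-sym      : ∀ i j g h → Δ i j g h ≡ Δ j i h g
    Δ-triangle : ∀ u l v x h y → Δ u v x y ≤ Δ u v x h + Δ l v x h + Δ l v x y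

module _ {n r} {A : Matrix n} (ds : DoublyStochastic r A) (D : Discrepancy n) (π : Fin n ↔ Fin n) where
  open DoublyStochastic ds
  open Discrepancy D

  private
    τ : Fin n → Fin n
    τ = Inverse.to π

  averaged-triangle : ∀ u v →
    r * r * Δ u v (τ u) (τ v) ≤
    r * sum (λ h → Δ u v (τ u) h * A v h)
    + sum (λ l → A l (τ u) * sum λ h → Δ l v (τ u) h * A v h)
    + r * sum (λ l → Δ l v (τ u) (τ v) * A l (τ u))
  averaged-triangle u v = begin
    r * r * Δ u v x y
      ≡⟨ weighted-const column (A v) (colSum x) (rowSum v) (Δ u v x y) ⟨
    sum (λ l → sum λ h → A l x * (A v h * Δ u v x y))
      ≤⟨ sum-mono-≤ (λ l → sum-mono-≤ (λ h → ℚ.*-monoˡ-≤-nonNeg (A l x) {{nonNegative (nonneg l x)}}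
           (ℚ.*-monoˡ-≤-nonNeg (A v h) {{nonNegative (nonneg v h)}} (Δ-triangle u l v x h y)))) ⟩
    sum (λ l → sum λ h → A l x * (A v h * (Δ u v x h + Δ l v x h + Δ l v x y)))
      ≡⟨ sum-cong (λ l → sum-cong (λ h → distribute (A l x) (A v h) (Δ u v x h) (Δ l v x h) (Δ l v x y))) ⟩
    sum (λ l → sum λ h → t₁ l h + t₂ l h + t₃ l h)
      ≡⟨ trans (sum²-distrib-+ (λ l h → t₁ l h + t₂ l h) t₃) (cong (_+ sum (sum ∘ t₃)) (sum²-distrib-+ t₁ t₂)) ⟩
    sum (sum ∘ t₁) + sum (sum ∘ t₂) + sum (sum ∘ t₃)
      ≡⟨ cong₂ _+_ (cong₂ _+_ (weighted-sumʳ column (A v) (colSum x) (rowSum v) (Δ u v x))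
                              (weighted-sum column (A v) (colSum x) (rowSum v) (λ l → Δ l v x)))
                   (weighted-sumˡ column (A v) (colSum x) (rowSum v) (λ l → Δ l v x y)) ⟩
    r * sum (λ h → Δ u v x h * A v h) + sum (λ l → A l x * sum λ h → Δ l v x h * A v h)
      + r * sum (λ l → Δ l v x y * A l x) ∎
    where
    open ℚ.≤-Reasoning
    x y : Fin n
    x = τ u
    y = τ v
    column : Fin n → ℚ
    column l = A l x
    t₁ t₂ t₃ : Fin n → Fin n → ℚ
    t₁ l h = A l x * (A v h * Δ u v x h)
    t₂ l h = A l x * (A v h * Δ l v x h)
    t₃ l h = A l x * (A v h * Δ l v x y)
    distribute : ∀ a b p q s → a * (b * (p + q + s)) ≡ a * (b * p) + a * (b * q) + a * (b * s)
    distribute = solve 5 (λ a b p q s → a :* (b :* (p :+ q :+ s)) := a :* (b :* p) :+ a :* (b :* q) :+ a :* (b :* s)) refl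

  misfit linearCost : ℚ
  misfit     = sum λ u → sum λ v → Δ u v (τ u) (τ v)
  linearCost = sum λ i → linearised Δ A i (τ i)

  sum-second-terms : sum (λ u → sum λ v → sum λ l → A l (τ u) * sum λ h → Δ l v (τ u) h * A v h)
                     ≡ cost (linearised Δ A) A
  sum-second-terms = begin
    sum (λ u → sum λ v → sum λ l → A l (τ u) * sum λ h → Δ l v (τ u) h * A v h)
      ≡⟨ sum-cong (λ u → Σℚ.∑-comm (λ v l → A l (τ u) * sum λ h → Δ l v (τ u) h * A v h)) ⟩
    sum (λ u → sum λ l → sum λ v → A l (τ u) * sum λ h → Δ l v (τ u) h * A v h)
      ≡⟨ sum-cong (λ u → sum-cong (λ l → Σℚ.*-distribˡ-sum (A l (τ u)) (λ v → sum λ h → Δ l v (τ u) h * A v h))) ⟨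
    sum (λ u → sum λ l → A l (τ u) * linearised Δ A l (τ u))
      ≡⟨ sum-permute π (λ k → sum λ l → A l k * linearised Δ A l k) ⟩
    sum (λ k → sum λ l → A l k * linearised Δ A l k)
      ≡⟨ Σℚ.∑-comm (λ k l → A l k * linearised Δ A l k) ⟩
    cost (linearised Δ A) A ∎
    where open ≡-Reasoning

  sum-third-terms : sum (λ u → sum λ v → r * sum λ l → Δ l v (τ u) (τ v) * A l (τ u)) ≡ r * linearCost
  sum-third-terms = begin
    sum (λ u → sum λ v → r * sum λ l → Δ l v (τ u) (τ v) * A l (τ u))
      ≡⟨ *-distribˡ-sum² r (λ u v → sum λ l → Δ l v (τ u) (τ v) * A l (τ u)) ⟨
    r * sum (λ u → sum λ v → sum λ l → Δ l v (τ u) (τ v) * A l (τ u))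
      ≡⟨ cong (r *_) (Σℚ.∑-comm (λ u v → sum λ l → Δ l v (τ u) (τ v) * A l (τ u))) ⟩
    r * sum (λ v → sum λ u → sum λ l → Δ l v (τ u) (τ v) * A l (τ u))
      ≡⟨ cong (r *_) (sum-cong (λ v → sum-permute π (λ k → sum λ l → Δ l v k (τ v) * A l k))) ⟩
    r * sum (λ v → sum λ k → sum λ l → Δ l v k (τ v) * A l k)
      ≡⟨ cong (r *_) (sum-cong (λ v → Σℚ.∑-comm (λ k l → Δ l v k (τ v) * A l k))) ⟩
    r * sum (λ v → sum λ l → sum λ k → Δ l v k (τ v) * A l k)
      ≡⟨ cong (r *_) (sum-cong (λ v → sum-cong (λ l → sum-cong (λ k → cong (_* A l k) (Δ-sym l v k (τ v)))))) ⟩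
    r * linearCost ∎
    where open ≡-Reasoning

  misfit-bound : r * r * misfit ≤ r * linearCost + cost (linearised Δ A) A + r * linearCost
  misfit-bound = begin
    r * r * misfit
      ≡⟨ *-distribˡ-sum² (r * r) (λ u v → Δ u v (τ u) (τ v)) ⟩
    sum (λ u → sum λ v → r * r * Δ u v (τ u) (τ v))
      ≤⟨ sum-mono-≤ (λ u → sum-mono-≤ (averaged-triangle u)) ⟩
    sum (λ u → sum λ v → first u v + second u v + third u v)
      ≡⟨ trans (sum²-distrib-+ (λ u v → first u v + second u v) third)
               (cong (_+ sum (sum ∘ third)) (sum²-distrib-+ first second)) ⟩
    sum (sum ∘ first) + sum (sum ∘ second) + sum (sum ∘ third)
      ≡⟨ cong₂ _+_ (cong₂ _+_ (sym (*-distribˡ-sum² r (λ u v → sum λ h → Δ u v (τ u) h * A v h))) sum-second-terms)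
                   sum-third-terms ⟩
    r * linearCost + cost (linearised Δ A) A + r * linearCost ∎
    where
    open ℚ.≤-Reasoning
    first second third : Fin n → Fin n → ℚ
    first u v  = r * sum (λ h → Δ u v (τ u) h * A v h)
    second u v = sum (λ l → A l (τ u) * sum λ h → Δ l v (τ u) h * A v h)
    third u v  = r * sum (λ l → Δ l v (τ u) (τ v) * A l (τ u))

-- Graphs

𝟙 : Bool → ℚ
𝟙 b = if b then 1ℚ else 0ℚ

≤-by-computation : ∀ {p q} {p≤q : True (p ℚ.≤? q)} → p ≤ q
≤-by-computation {p≤q = p≤q} = toWitness p≤q

xor-triangle : ∀ a b c d → 𝟙 (a xor d) ≤ 𝟙 (a xor b) + 𝟙 (c xor b) + 𝟙 (c xor d)
xor-triangle false false false false = ≤-by-computation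
xor-triangle false false false true  = ≤-by-computation
xor-triangle false false true  false = ≤-by-computation
xor-triangle false false true  true  = ≤-by-computation
xor-triangle false true  false false = ≤-by-computation
xor-triangle false true  false true  = ≤-by-computation
xor-triangle false true  true  false = ≤-by-computation
xor-triangle false true  true  true  = ≤-by-computation
xor-triangle true  false false false = ≤-by-computation
xor-triangle true  false false true  = ≤-by-computation
xor-triangle true  false true  false = ≤-by-computation
xor-triangle true  false true  true  = ≤-by-computation
xor-triangle true  true  false false = ≤-by-computation
xor-triangle true  true  false true  = ≤-by-computation
xor-triangle true  true  true  false = ≤-by-computation
xor-triangle true  true  true  true  = ≤-by-computation

upper : ∀ {n} → (Fin n → Fin n → Bool) → Fin n → Fin n → Bool
upper X u v = if does (u <? v) then X u v else false

ordered-pairs : ∀ {n} (X : Fin n → Fin n → Bool) → (∀ u v → X u v ≡ X v u) → (∀ u → X u u ≡ false) →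
                sum (λ u → sum λ v → 𝟙 (X u v)) ≡ (1ℚ + 1ℚ) * sum (λ u → sum λ v → 𝟙 (upper X u v))
ordered-pairs {n} X X-sym X-irrefl = begin
  sum (λ u → sum λ v → 𝟙 (X u v))
    ≡⟨ sum-cong (λ u → sum-cong (λ v → split u v)) ⟩
  sum (λ u → sum λ v → 𝟙 (upper X u v) + 𝟙 (upper X v u))
    ≡⟨ sum²-distrib-+ (λ u v → 𝟙 (upper X u v)) (λ u v → 𝟙 (upper X v u)) ⟩
  Y + sum (λ u → sum λ v → 𝟙 (upper X v u))
    ≡⟨ cong (Y +_) (Σℚ.∑-comm (λ u v → 𝟙 (upper X u v))) ⟨
  Y + Y
    ≡⟨ solve 1 (λ y → y :+ y := (con 1ℚ :+ con 1ℚ) :* y) refl Y ⟩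
  (1ℚ + 1ℚ) * Y ∎
  where
  open ≡-Reasoning
  Y : ℚ
  Y = sum (λ u → sum λ v → 𝟙 (upper X u v))
  upper-< : ∀ {u v} → u Fin.< v → upper X u v ≡ X u v
  upper-< {u} {v} u<v = cong (if_then X u v else false) (dec-true (u <? v) u<v)
  upper-≮ : ∀ {u v} → ¬ u Fin.< v → upper X u v ≡ false
  upper-≮ {u} {v} u≮v = cong (if_then X u v else false) (dec-false (u <? v) u≮v)
  split : ∀ u v → 𝟙 (X u v) ≡ 𝟙 (upper X u v) + 𝟙 (upper X v u)
  split u v with Fin.<-cmp u v
  ... | tri< u<v _ v≮u = sym (trans (cong₂ _+_ (cong 𝟙 (upper-< u<v)) (cong 𝟙 (upper-≮ v≮u))) (ℚ.+-identityʳ _))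
  ... | tri> u≮v _ v<u = sym (trans (cong₂ _+_ (cong 𝟙 (upper-≮ u≮v)) (cong 𝟙 (upper-< v<u)))
                                    (trans (ℚ.+-identityˡ _) (cong 𝟙 (X-sym v u))))
  ... | tri≈ u≮u refl _ = trans (cong 𝟙 (X-irrefl u)) (sym (cong₂ _+_ (cong 𝟙 (upper-≮ u≮u)) (cong 𝟙 (upper-≮ u≮u))))

∑≡sum : ∀ n (f : Fin n → ℚ) → ∑ n f ≡ sum f
∑≡sum zero    f = refl
∑≡sum (suc n) f = cong (f zero +_) (∑≡sum n (f ∘ suc))

∑≡sum-cong : ∀ n {f g : Fin n → ℚ} → (∀ i → f i ≡ g i) → ∑ n f ≡ sum g
∑≡sum-cong n {f} f≡g = trans (∑≡sum n f) (sum-cong f≡g)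

fromℚᵘ-homo-+ : ∀ p q → ℚ.fromℚᵘ (p ℚᵘ.+ q) ≡ ℚ.fromℚᵘ p + ℚ.fromℚᵘ q
fromℚᵘ-homo-+ p q = ℚ.toℚᵘ-injective (ℚᵘ.≃-trans (ℚ.toℚᵘ-fromℚᵘ (p ℚᵘ.+ q))
  (ℚᵘ.≃-sym (ℚᵘ.≃-trans (ℚ.toℚᵘ-homo-+ (ℚ.fromℚᵘ p) (ℚ.fromℚᵘ q)) (ℚᵘ.+-cong (ℚ.toℚᵘ-fromℚᵘ p) (ℚ.toℚᵘ-fromℚᵘ q)))))

fromℚᵘ-homo-* : ∀ p q → ℚ.fromℚᵘ (p ℚᵘ.* q) ≡ ℚ.fromℚᵘ p * ℚ.fromℚᵘ q
fromℚᵘ-homo-* p q = ℚ.toℚᵘ-injective (ℚᵘ.≃-trans (ℚ.toℚᵘ-fromℚᵘ (p ℚᵘ.* q))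
  (ℚᵘ.≃-sym (ℚᵘ.≃-trans (ℚ.toℚᵘ-homo-* (ℚ.fromℚᵘ p) (ℚ.fromℚᵘ q)) (ℚᵘ.*-cong (ℚ.toℚᵘ-fromℚᵘ p) (ℚ.toℚᵘ-fromℚᵘ q)))))

fromℕ : ℕ → ℚ
fromℕ k = ℤ.+ k / 1

fromℕ-+ : ∀ a b → fromℕ (a ℕ.+ b) ≡ fromℕ a + fromℕ b
fromℕ-+ a b = begin
  ℚ.fromℚᵘ (ℚᵘ.mkℚᵘ (ℤ.+ (a ℕ.+ b)) 0)                         ≡⟨ ℚ.fromℚᵘ-cong equation ⟩
  ℚ.fromℚᵘ (ℚᵘ.mkℚᵘ (ℤ.+ a) 0 ℚᵘ.+ ℚᵘ.mkℚᵘ (ℤ.+ b) 0)          ≡⟨ fromℚᵘ-homo-+ (ℚᵘ.mkℚᵘ (ℤ.+ a) 0) (ℚᵘ.mkℚᵘ (ℤ.+ b) 0) ⟩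
  fromℕ a + fromℕ b                                             ∎
  where
  open ≡-Reasoning
  equation : ℚᵘ.mkℚᵘ (ℤ.+ (a ℕ.+ b)) 0 ℚᵘ.≃ ℚᵘ.mkℚᵘ (ℤ.+ a) 0 ℚᵘ.+ ℚᵘ.mkℚᵘ (ℤ.+ b) 0
  equation = ℚᵘ.*≡* $ trans (ℤ.*-identityʳ _) (sym (trans (ℤ.*-identityʳ _)
                 (cong₂ ℤ._+_ (ℤ.*-identityʳ (ℤ.+ a)) (ℤ.*-identityʳ (ℤ.+ b)))))

fromℕ-∑ℕ : ∀ n (f : Fin n → ℕ) → fromℕ (∑ℕ n f) ≡ sum (fromℕ ∘ f)
fromℕ-∑ℕ zero    f = refl
fromℕ-∑ℕ (suc n) f = trans (fromℕ-+ (f zero) _) (cong (fromℕ (f zero) +_) (fromℕ-∑ℕ n (f ∘ suc)))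

fromℕ-count : ∀ n (p : Fin n → Bool) → fromℕ (count n p) ≡ sum (𝟙 ∘ p)
fromℕ-count zero    p = refl
fromℕ-count (suc n) p = trans (fromℕ-+ (if p zero then 1 else 0) (count n (p ∘ suc)))
                              (cong₂ _+_ (fromℕ-indicator (p zero)) (fromℕ-count n (p ∘ suc)))
  where
  fromℕ-indicator : ∀ b → fromℕ (if b then 1 else 0) ≡ 𝟙 b
  fromℕ-indicator true  = refl
  fromℕ-indicator false = refl

2/n²≡2*[1/n]² : ∀ m → ℤ.+ 2 / (suc m ℕ.* suc m) ≡ (1ℚ + 1ℚ) * ((ℤ.+ 1 / suc m) * (ℤ.+ 1 / suc m))
2/n²≡2*[1/n]² m = begin
  ℚ.fromℚᵘ (ℚᵘ.mkℚᵘ (ℤ.+ 2) (m ℕ.+ m ℕ.* suc m))   ≡⟨ ℚ.fromℚᵘ-cong equation ⟩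
  ℚ.fromℚᵘ (two ℚᵘ.* (r ℚᵘ.* r))                    ≡⟨ fromℚᵘ-homo-* two (r ℚᵘ.* r) ⟩
  ℚ.fromℚᵘ two * ℚ.fromℚᵘ (r ℚᵘ.* r)                ≡⟨ cong ((1ℚ + 1ℚ) *_) (fromℚᵘ-homo-* r r) ⟩
  (1ℚ + 1ℚ) * (ℚ.fromℚᵘ r * ℚ.fromℚᵘ r)            ∎
  where
  open ≡-Reasoning
  two r : ℚᵘ.ℚᵘ
  two = ℚᵘ.mkℚᵘ (ℤ.+ 2) 0
  r = ℚᵘ.mkℚᵘ (ℤ.+ 1) m
  equation : ℚᵘ.mkℚᵘ (ℤ.+ 2) (m ℕ.+ m ℕ.* suc m) ℚᵘ.≃ two ℚᵘ.* (r ℚᵘ.* r)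
  equation = ℚᵘ.*≡* (cong (λ k → ℤ.+ 2 ℤ.* ℤ.+ k) (ℕ.*-identityˡ (suc m ℕ.* suc m)))

module _ {n} (G H : Graph n) where

  mismatch : Fin n → Fin n → Fin n → Fin n → ℚ
  mismatch i j g h = 𝟙 (adj G i j xor adj H g h)

  mismatch-discrepancy : Discrepancy n
  mismatch-discrepancy = record
    { Δ          = mismatch
    ; Δ-sym      = λ i j g h → cong 𝟙 (cong₂ _xor_ (Graph.sym G i j) (Graph.sym H g h))
    ; Δ-triangle = λ u l v x h y → xor-triangle (adj G u v) (adj H x h) (adj G l v) (adj H x y)
    }

  fracCost≡cost : ∀ A → fracCost G H A ≡ cost (linearised mismatch A) A
  fracCost≡cost A = begin
    fracCost G H A
      ≡⟨ ∑≡sum-cong n (λ i → ∑≡sum-cong n λ j → ∑≡sum-cong n λ g → ∑≡sum n _) ⟩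
    sum (λ i → sum λ j → sum λ g → sum λ h → if adj G i j xor adj H g h then A i g * A j h else 0ℚ)
      ≡⟨ sum-cong (λ i → sum-cong λ j → sum-cong λ g → sum-cong λ h → select (adj G i j xor adj H g h) (A i g) (A j h)) ⟩
    sum (λ i → sum λ j → sum λ g → sum λ h → A i g * (mismatch i j g h * A j h))
      ≡⟨ sum-cong (λ i → Σℚ.∑-comm (λ j g → sum λ h → A i g * (mismatch i j g h * A j h))) ⟩
    sum (λ i → sum λ g → sum λ j → sum λ h → A i g * (mismatch i j g h * A j h))
      ≡⟨ sum-cong (λ i → sum-cong λ g → *-distribˡ-sum² (A i g) (λ j h → mismatch i j g h * A j h)) ⟨
    cost (linearised mismatch A) A ∎
    where
    open ≡-Reasoning
    select : ∀ b a x → (if b then a * x else 0ℚ) ≡ a * (𝟙 b * x)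
    select true  a x = cong (a *_) (sym (ℚ.*-identityˡ x))
    select false a x = sym (trans (cong (a *_) (ℚ.*-zeroˡ x)) (ℚ.*-zeroʳ a))

editValue≡misfit : ∀ {m} (G H : Graph (suc m)) (σ : Fin (suc m) ↔ Fin (suc m)) →
  editValue G H σ ≡ (ℤ.+ 1 / suc m) * (ℤ.+ 1 / suc m) *
                    sum (λ u → sum λ v → mismatch G H u v (Inverse.from σ u) (Inverse.from σ v))
editValue≡misfit {m} G H σ = begin
  ℤ.+ 2 / (suc m ℕ.* suc m) * fromℕ (symDiffSize G H σ)
    ≡⟨ cong₂ _*_ (2/n²≡2*[1/n]² m) (trans (fromℕ-∑ℕ (suc m) (λ u → count (suc m) (upper X u)))
                                          (sum-cong (λ u → fromℕ-count (suc m) (upper X u)))) ⟩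
  (1ℚ + 1ℚ) * (r * r) * sum (λ u → sum λ v → 𝟙 (upper X u v))
    ≡⟨ solve 3 (λ t r s → t :* (r :* r) :* s := r :* r :* (t :* s)) refl (1ℚ + 1ℚ) r _ ⟩
  r * r * ((1ℚ + 1ℚ) * sum (λ u → sum λ v → 𝟙 (upper X u v)))
    ≡⟨ cong (r * r *_) (ordered-pairs X X-sym X-irrefl) ⟨
  r * r * sum (λ u → sum λ v → 𝟙 (X u v)) ∎
  where
  open ≡-Reasoning
  r : ℚ
  r = ℤ.+ 1 / suc m
  τ : Fin (suc m) → Fin (suc m)
  τ = Inverse.from σ
  X : Fin (suc m) → Fin (suc m) → Bool
  X u v = adj G u v xor adj H (τ u) (τ v)
  X-sym : ∀ u v → X u v ≡ X v u
  X-sym u v = cong₂ _xor_ (Graph.sym G u v) (Graph.sym H (τ u) (τ v))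
  X-irrefl : ∀ u → X u u ≡ false
  X-irrefl u = cong₂ _xor_ (Graph.irrefl G u) (Graph.irrefl H (τ u))

coupling⇒doublyStochastic : ∀ {n} .{{_ : NonZero n}} {A : Matrix n} → IsCoupling n A → DoublyStochastic (ℤ.+ 1 / n) A
coupling⇒doublyStochastic {n} coupling = record
  { nonneg = nonneg
  ; rowSum = λ i → trans (sym (∑≡sum n _)) (rows i)
  ; colSum = λ g → trans (sym (∑≡sum n _)) (cols g)
  }
  where open IsCoupling coupling

lemma14 : (n : ℕ) → .{{_ : NonZero n}} → (G H : Graph n) →
          (A : Fin n → Fin n → ℚ) → IsCoupling n A →
          ∃ λ (σ : Fin n ↔ Fin n) → editValue G H σ ≤ (1ℚ + 1ℚ + 1ℚ) * fracCost G H A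
lemma14 zero {{()}}
lemma14 (suc m) G H A coupling = ↔-sym π , (begin
  editValue G H (↔-sym π)              ≡⟨ editValue≡misfit G H (↔-sym π) ⟩
  r * r * misfit ds D π                ≤⟨ misfit-bound ds D π ⟩
  r * C + F + r * C                    ≤⟨ ℚ.+-mono-≤ (ℚ.+-monoˡ-≤ F cheap) cheap ⟩
  F + F + F                            ≡⟨ solve 1 (λ f → f :+ f :+ f := (con 1ℚ :+ con 1ℚ :+ con 1ℚ) :* f) refl F ⟩
  (1ℚ + 1ℚ + 1ℚ) * F                   ≡⟨ cong ((1ℚ + 1ℚ + 1ℚ) *_) (fracCost≡cost G H A) ⟨
  (1ℚ + 1ℚ + 1ℚ) * fracCost G H A      ∎)
  where
  open ℚ.≤-Reasoning
  r : ℚ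
  r = ℤ.+ 1 / suc m
  ds : DoublyStochastic r A
  ds = coupling⇒doublyStochastic coupling
  D : Discrepancy (suc m)
  D = mismatch-discrepancy G H
  c : Matrix (suc m)
  c = linearised (mismatch G H) A
  F : ℚ
  F = cost c A
  assignment : ∃ λ (π : Fin (suc m) ↔ Fin (suc m)) → r * sum (λ i → c i (Inverse.to π i)) ≤ F
  assignment = permutation-cost-≤ {c = c} (ℚ.positive⁻¹ r {{ℚ.normalize-pos 1 (suc m)}}) ds
  π : Fin (suc m) ↔ Fin (suc m)
  π = proj₁ assignment
  C : ℚ
  C = sum λ i → c i (Inverse.to π i)
  cheap : r * C ≤ F
  cheap = proj₂ assignment
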